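{- Let $K$ be a finite field of characteristic $p$ and order $q$, let $s$ be a positive integer with $\gcd(s,q-1)=1$, and suppose $\tau$ has order $m$. Let $A_0,A_1,\dots,A_{k-1}$ be distinct elements of $\mathcal{W}_{K,s}$ that $\tau$ permutes in a $k$-cycle, i.e. $\tau(A_i)=A_{i+1}$ for all $i\in\mathbb{Z}/k\mathbb{Z}$. Then $k\mid m$ and $N_{A_0}=N_{A_1}=\cdots=N_{A_{k-1}}$, and this common value is a multiple of $m/k$.
   Context: Let $\zeta=\exp(2\pi i/p)$, $\psi(x)=\zeta^{\mathrm{Tr}(x)}$ with $\mathrm{Tr}\colon K\to\mathbb{F}_p$ the absolute trace, $W_u=\sum_{x\in K}\psi(x^s-ux)$ for $u\in K$, $\mathcal{W}_{K,s}=\{W_u: u\in K^\times\}$, and for $A\in\mathbb{Z}[\zeta]$, $N_A=|\{u\in K^\times: W_u=A\}|$. Let $\gamma$ be a generator of $\mathbb{F}_p^\times$ and $\sigma\in\mathrm{Gal}(\mathbb{Q}(\zeta)/\mathbb{Q})$ with $\sigma(\zeta)=\zeta^\gamma$. It is known that $\sigma(W_u)=W_{\gamma^{1-1/s}u}$ for all $u\in K$ (with $1/s$ the inverse of $s$ mod $p-1$), so $\sigma$ maps $\mathcal{W}_{K,s}$ to itself; $\tau$ is the permutation of $\mathcal{W}_{K,s}$ given by restricting $\sigma$. -}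

module Defs where

open import Level using (0ℓ)
open import Data.Nat as ℕ using (ℕ; zero; suc; _<_; NonZero)
open import Data.Nat.DivMod using (_%_)
open import Data.Nat.Divisibility using (_∣_)
open import Data.Integer as ℤ using (ℤ; +_)
open import Data.Fin using (Fin; toℕ)
open import Data.Fin.Properties using (all?)
open import Data.List using (List; []; _∷_; filter; length; map; foldr; allFin)
open import Data.List.Membership.Propositional using (_∈_)
open import Data.List.Relation.Unary.Unique.Propositional using (Unique)
open import Data.Product using (Σ; ∃; _×_; _,_)
open import Relation.Nullary using (¬_; Dec; yes; no)

open import Relation.Nullary.Decidable using (_×-dec_; ¬?)
open import Relation.Binary.Definitions using (DecidableEquality)
open import Relation.Binary.PropositionalEquality using (_≡_)
open import Algebra.Structures using (IsCommutativeRing)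

record FiniteField : Set₁ where
  infixl 7 _*_
  infixl 6 _+_
  field
    Carrier  : Set
    _+_ _*_  : Carrier → Carrier → Carrier
    -_       : Carrier → Carrier
    0# 1#    : Carrier
    isCommutativeRing : IsCommutativeRing _≡_ _+_ _*_ -_ 0# 1#
    0≢1      : ¬ (0# ≡ 1#)
    inverse  : ∀ x → ¬ (x ≡ 0#) → ∃ λ y → x * y ≡ 1#
    _≟_      : DecidableEquality Carrier
    elements : List Carrier
    elements-complete : ∀ x → x ∈ elements
    elements-unique   : Unique elements

  order : ℕ
  order = length elements

  _^_ : Carrier → ℕ → Carrier
  x ^ zero  = 1#
  x ^ suc n = x * (x ^ n)

  _×1 : ℕ → Carrier
  zero  ×1 = 0#
  suc n ×1 = 1# + (n ×1)

  _-_ : Carrier → Carrier → Carrier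
  x - y = x + (- y)

open FiniteField public using (Carrier)

-- Z[ζ], ζ = exp(2πi/p), p prime, represented as Z[x]/(1+x+…+x^(p-1)):
-- an element is a coefficient vector (a_0,…,a_{p-1}) standing for
-- Σ a_j ζ^j; two vectors represent the same element iff their
-- difference is a constant vector (multiple of 1+ζ+…+ζ^(p-1) = 0).

ℤ[ζ] : ℕ → Set
ℤ[ζ] p = Fin p → ℤ

_≈ζ_ : ∀ {p} → ℤ[ζ] p → ℤ[ζ] p → Set
a ≈ζ b = ∀ i j → a i ℤ.- b i ≡ a j ℤ.- b j

_≈ζ?_ : ∀ {p} (a b : ℤ[ζ] p) → Dec (a ≈ζ b)
a ≈ζ? b = all? λ i → all? λ j → (a i ℤ.- b i) ℤ.≟ (a j ℤ.- b j)

-- a mod p (with a mod 0 = a, never used since p is prime)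
modℕ : ℕ → ℕ → ℕ
modℕ a zero    = a
modℕ a (suc p) = a % suc p

sumℤ : List ℤ → ℤ
sumℤ = foldr ℤ._+_ (+ 0)

-- σ : ζ ↦ ζ^γ, i.e. σ(Σ a_j ζ^j) = Σ a_j ζ^(γ j)
σ : ∀ {p} → ℕ → ℤ[ζ] p → ℤ[ζ] p
σ {p} γ a i = sumℤ (map coeff (allFin p))
  where
  coeff : Fin p → ℤ
  coeff j with toℕ i ℕ.≟ modℕ (γ ℕ.* toℕ j) p
  ... | yes _ = a j
  ... | no  _ = + 0

σ^ : ∀ {p} → ℕ → ℕ → ℤ[ζ] p → ℤ[ζ] p
σ^ γ zero    a = a
σ^ γ (suc j) a = σ γ (σ^ γ j a)

IsGenerator : ℕ → ℕ → Set
IsGenerator p γ = 0 < γ × γ < p × (∀ j → 0 < j → j < p ℕ.∸ 1 → ¬ (p ∣ (γ ℕ.^ j) ℕ.∸ 1))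

-- Trace, Weil sums, the set W_{K,s}, N_A.  Parameters: the field K,
-- its characteristic p, the degree n (q = p^n), the exponent s.

module WeilSums (K : FiniteField) (p n s : ℕ) where
  open FiniteField K hiding (Carrier)

  -- absolute trace Tr(x) = x + x^p + … + x^(p^(n-1)) (an element of
  -- the prime field {0·1, …, (p-1)·1} ≅ F_p)
  Tr : Carrier K → Carrier K
  Tr x = go n
    where
    go : ℕ → Carrier K
    go zero    = 0#
    go (suc i) = (x ^ (p ℕ.^ i)) + go i

  -- W_u = Σ_x ψ(x^s - u x) = Σ_j c_j ζ^j with
  -- c_j = |{x ∈ K : Tr(x^s - u x) = j·1}|
  W : Carrier K → ℤ[ζ] p
  W u j = + length (filter (λ x → Tr ((x ^ s) - (u * x)) ≟ (toℕ j ×1)) elements)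

  InW : ℤ[ζ] p → Set
  InW A = ∃ λ u → ¬ (u ≡ 0#) × W u ≈ζ A

  N : ℤ[ζ] p → ℕ
  N A = length (filter (λ u → ¬? (u ≟ 0#) ×-dec (W u ≈ζ? A)) elements)

  -- τ (restriction of σ to W_{K,s}) has order m
  τHasOrder : ℕ → ℕ → Set
  τHasOrder γ m =
    0 < m
    × (∀ A → InW A → σ^ γ m A ≈ζ A)
    × (∀ j → 0 < j → j < m → ¬ (∀ A → InW A → σ^ γ j A ≈ζ A))

{-# OPTIONS --safe #-}
-- Let a = γ·1, an element of the prime field of K. Since a^(p−1) = 1 (Fermat, itself an instance
-- of the orbit counting used at the end) and gcd(s, p − 1) = 1, a has an s-th root b; put c = a/b. The
-- substitution x ↦ b x and the F_p-linearity of the trace give W_{c u} = σ(W_u), so σ acts on Weil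
-- sums as multiplication of u by c. Hence σ preserves N, which is therefore constant along the
-- cycle, and k ∣ m because σ^m fixes A_0 while the A_i are distinct. Finally {u ≠ 0 : W_u = A_0} is
-- stable under multiplication by c^k, so it is a union of orbits of size t = ord(c^k) and t ∣ N_{A_0};
-- as σ^(k t) is the identity on W_{K,s}, m ∣ k t, that is m/k ∣ t.
module Submission where

open import Defs
open import Level using (0ℓ)
open import Algebra.Bundles using (CommutativeRing)
import Algebra.Properties.CommutativeSemiring.Exp as SemiringExp
import Algebra.Properties.Group as GroupProperties
import Algebra.Properties.Ring as RingProperties
import Algebra.Properties.Semiring.Mult as SemiringMult
open import Data.Fin using (Fin; toℕ; fromℕ<)
open import Data.Fin.Properties using (pigeonhole; toℕ-fromℕ<; toℕ-injective; toℕ<n)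
open import Data.Integer as ℤ using (ℤ; 0ℤ)
import Data.Integer.Properties as ℤ
import Data.Integer.Solver as ℤ-Solver
open import Data.List using (List; []; _∷_; length; filter; map; applyUpTo; lookup; allFin)
open import Data.List.Properties using (length-map; length-applyUpTo; filter-none; filter-≐)
open import Data.List.Membership.Propositional using (_∈_; _∉_)
open import Data.List.Membership.Propositional.Properties
  using (∈-filter⁺; ∈-filter⁻; ∈-map⁺; ∈-map⁻; ∈-applyUpTo⁺; ∈-applyUpTo⁻; ∈-allFin)
open import Data.List.Membership.Propositional.Properties.WithK using (unique∧set⇒bag)
import Data.List.Membership.DecPropositional as DecMembership
open import Data.List.Relation.Binary.BagAndSetEquality using (∼bag⇒↭)
open import Data.List.Relation.Binary.Permutation.Propositional.Properties using (↭-length)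
open import Data.List.Relation.Unary.All as All using (All; []; _∷_)
open import Data.List.Relation.Unary.All.Properties using (¬Any⇒All¬)
open import Data.List.Relation.Unary.AllPairs using (_∷_)
open import Data.List.Relation.Unary.Any using (here; there; any?; satisfied; index)
open import Data.List.Relation.Unary.Any.Properties using (lookup-index)
open import Data.List.Relation.Unary.Unique.Propositional using (Unique)
import Data.List.Relation.Unary.Unique.Propositional.Properties as Unique
open import Data.Nat as ℕ using (ℕ; zero; suc; _<_; _≤_; z≤n; s≤s; NonZero; nonTrivial⇒n>1)
import Data.Nat.Properties as ℕ
open import Data.Nat.Coprimality using (Coprime; gcd≡1⇒coprime; prime⇒coprime; coprime-Bézout)
open import Data.Nat.DivMod
  using (_%_; _/_; m%n<n; m≡m%n+[m/n]*n; m*n/n≡m; m%n%n≡m%n; %-distribˡ-+; %-distribˡ-*;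
         [m+kn]%n≡m%n; m<n⇒m%n≡m; n%n≡0)
open import Data.Nat.Divisibility
  using (_∣_; divides; _∣0; ∣-refl; ∣-trans; m∣m*n; ∣m∣n⇒∣m+n; m%n≡0⇒n∣m; *-cancelʳ-∣)
open import Data.Nat.GCD using (gcd; module Bézout)
open import Data.Nat.Induction using (<-wellFounded)
open import Data.Nat.Primality using (Prime; prime⇒nonTrivial; ¬prime[0])
import Data.Nat.Solver as ℕ-Solver
open import Data.Product using (Σ; ∃; ∃₂; _×_; _,_; proj₁; proj₂; map₂)
open import Data.Sum using (_⊎_; inj₁; inj₂)
open import Function.Base using (_∘_)
open import Function.Bundles using (_⇔_; mk⇔)
open import Induction.WellFounded using (Acc; acc)
open import Relation.Nullary using (¬_; yes; no; contradiction)
open import Relation.Nullary.Decidable using (_×-dec_; ¬?)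
open import Relation.Unary using (Pred; Decidable)
open import Relation.Unary.Properties using (_∩?_; ∁?)
open import Relation.Binary.Bundles using (Setoid)
open import Relation.Binary.PropositionalEquality
  using (_≡_; _≢_; refl; sym; trans; cong; cong₂; subst; module ≡-Reasoning)
import Relation.Binary.Reasoning.Setoid as SetoidReasoning

IsLeast : Pred ℕ 0ℓ → ℕ → Set
IsLeast P n = P n × (∀ {j} → j < n → ¬ P j)

least-witness : {P : Pred ℕ 0ℓ} → Decidable P → ∀ {n} → P n → ∃ (IsLeast P)
least-witness {P} P? {n} = go n (<-wellFounded n)
  where
  go : ∀ n → Acc _<_ n → P n → ∃ (IsLeast P)
  go n (acc smaller) Pn with ℕ.anyUpTo? P? n
  ... | yes (j , j<n , Pj) = go j (smaller j<n) Pj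
  ... | no none            = n , Pn , λ j<n Pj → none (_ , j<n , Pj)

least-period-∣ : {P : Pred ℕ 0ℓ} →
  (∀ a b → P a → P b → P (a ℕ.+ b)) →
  (∀ a b → P (a ℕ.+ b) → P b → P a) →
  ∀ {m} → IsLeast (λ j → 0 < j × P j) m → ∀ {r} → P r → m ∣ r
least-period-∣ {P} +-closed ∸-closed {m} ((0<m , Pm) , minimal) {r} Pr =
  m%n≡0⇒n∣m r m r%m≡0
  where
  instance
    m≢0 : NonZero m
    m≢0 = ℕ.>-nonZero 0<m

  multiples : ∀ q → P (q ℕ.* m)
  multiples zero    = ∸-closed 0 m Pm Pm
  multiples (suc q) = +-closed m (q ℕ.* m) Pm (multiples q)

  remainder : P (r % m)
  remainder = ∸-closed (r % m) (r / m ℕ.* m) (subst P (m≡m%n+[m/n]*n r m) Pr) (multiples (r / m))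

  r%m≡0 : r % m ≡ 0
  r%m≡0 with r % m in eq
  ... | zero  = refl
  ... | suc _ = contradiction (s≤s z≤n , subst P eq remainder)
                  (minimal (subst (_< m) eq (m%n<n r m)))

[m%n+1]%n≡[1+m]%n : ∀ m n .{{_ : NonZero n}} → (m % n ℕ.+ 1) % n ≡ suc m % n
[m%n+1]%n≡[1+m]%n m n = begin
  (m % n ℕ.+ 1) % n             ≡⟨ %-distribˡ-+ (m % n) 1 n ⟩
  (m % n % n ℕ.+ 1 % n) % n     ≡⟨ cong (λ z → (z ℕ.+ 1 % n) % n) (m%n%n≡m%n m n) ⟩
  (m % n ℕ.+ 1 % n) % n         ≡⟨ %-distribˡ-+ m 1 n ⟨
  (m ℕ.+ 1) % n                 ≡⟨ cong (_% n) (ℕ.+-comm m 1) ⟩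
  suc m % n                     ∎
  where open ≡-Reasoning

m∣n*o⇒m/n∣o : ∀ {m n o} .{{_ : NonZero n}} → n ∣ m → m ∣ n ℕ.* o → m / n ∣ o
m∣n*o⇒m/n∣o {n = n} {o} (divides q refl) qn∣no =
  subst (_∣ o) (sym (m*n/n≡m q n)) (*-cancelʳ-∣ n (subst (q ℕ.* n ∣_) (ℕ.*-comm n o) qn∣no))

*-inverse-%-cancel : ∀ u v x {d} .{{_ : NonZero d}} → (u ℕ.* v) % d ≡ 1 → (u ℕ.* ((v ℕ.* x) % d)) % d ≡ x % d
*-inverse-%-cancel u v x {d} uv≡1 = begin
  (u ℕ.* ((v ℕ.* x) % d)) % d                 ≡⟨ %-distribˡ-* u _ d ⟩
  (u % d ℕ.* ((v ℕ.* x) % d % d)) % d         ≡⟨ cong (λ z → (u % d ℕ.* z) % d) (m%n%n≡m%n (v ℕ.* x) d) ⟩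
  (u % d ℕ.* ((v ℕ.* x) % d)) % d             ≡⟨ %-distribˡ-* u (v ℕ.* x) d ⟨
  (u ℕ.* (v ℕ.* x)) % d                       ≡⟨ cong (_% d) (ℕ.*-assoc u v x) ⟨
  (u ℕ.* v ℕ.* x) % d                         ≡⟨ %-distribˡ-* (u ℕ.* v) x d ⟩
  ((u ℕ.* v) % d ℕ.* (x % d)) % d             ≡⟨ cong (λ z → (z ℕ.* (x % d)) % d) uv≡1 ⟩
  (1 ℕ.* (x % d)) % d                         ≡⟨ cong (_% d) (ℕ.*-identityˡ (x % d)) ⟩
  x % d % d                                   ≡⟨ m%n%n≡m%n x d ⟩
  x % d                                       ∎
  where open ≡-Reasoning

[1+m]^n≡1+m*k : ∀ m n → ∃ λ k → suc m ℕ.^ n ≡ 1 ℕ.+ m ℕ.* k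
[1+m]^n≡1+m*k m zero    = 0 , cong suc (sym (ℕ.*-zeroʳ m))
[1+m]^n≡1+m*k m (suc n) with k , eq ← [1+m]^n≡1+m*k m n =
  1 ℕ.+ suc m ℕ.* k ,
  trans (cong (suc m ℕ.*_) eq)
        (solve 2 (λ m k → (con 1 :+ m) :* (con 1 :+ m :* k) := con 1 :+ m :* (con 1 :+ (con 1 :+ m) :* k)) refl m k)
  where open ℕ-Solver.+-*-Solver

gcd[s,[1+m]^n∸1]≡1⇒coprime : ∀ {s m} n → gcd s (suc m ℕ.^ n ℕ.∸ 1) ≡ 1 → Coprime s m
gcd[s,[1+m]^n∸1]≡1⇒coprime {s} {m} n gcd≡1 {d} (d∣s , d∣m) with k , eq ← [1+m]^n≡1+m*k m n =
  gcd≡1⇒coprime gcd≡1 (d∣s , subst (d ∣_) (sym (trans (cong (ℕ._∸ 1) eq) (ℕ.m+n∸m≡n 1 (m ℕ.* k))))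
                                  (∣-trans d∣m (m∣m*n k)))

mod-inverse : ∀ {m g} → Prime (suc m) → .{{_ : NonZero g}} → g < suc m → ∃ λ h → (g ℕ.* h) % suc m ≡ 1
mod-inverse {m} {g} p-prime g<p = let h , c , x , eq = bézout-form in h , (begin
  (g ℕ.* h) % p                ≡⟨ sym ([m+kn]%n≡m%n (g ℕ.* h) c p) ⟩
  (g ℕ.* h ℕ.+ c ℕ.* p) % p    ≡⟨ cong (_% p) eq ⟩
  (1 ℕ.+ x ℕ.* p) % p          ≡⟨ [m+kn]%n≡m%n 1 x p ⟩
  1 % p                        ≡⟨ m<n⇒m%n≡m (nonTrivial⇒n>1 p {{prime⇒nonTrivial p-prime}}) ⟩
  1                            ∎)
  where
  open ≡-Reasoning
  open ℕ-Solver.+-*-Solver using (solve; _:+_; _:*_; _:=_; con)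
  p = suc m
  bézout-form : ∃ λ h → ∃₂ λ c x → g ℕ.* h ℕ.+ c ℕ.* p ≡ 1 ℕ.+ x ℕ.* p
  bézout-form with coprime-Bézout (prime⇒coprime p-prime g<p)
  ... | Bézout.-+ x y eq = y , 0 , x , trans (ℕ.+-identityʳ _) (trans (ℕ.*-comm g y) (sym eq))
  -- Here y g ≡ −1 (mod p), so y (p − 1) inverts g.
  ... | Bézout.+- x y eq = y ℕ.* m , 1 , x ℕ.* m , (begin
    g ℕ.* (y ℕ.* m) ℕ.+ 1 ℕ.* p
      ≡⟨ solve 3 (λ g y m → g :* (y :* m) :+ con 1 :* (con 1 :+ m) := (con 1 :+ y :* g) :* m :+ con 1) refl g y m ⟩
    (1 ℕ.+ y ℕ.* g) ℕ.* m ℕ.+ 1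
      ≡⟨ cong (λ z → z ℕ.* m ℕ.+ 1) eq ⟩
    x ℕ.* p ℕ.* m ℕ.+ 1
      ≡⟨ solve 2 (λ x m → x :* (con 1 :+ m) :* m :+ con 1 := con 1 :+ x :* m :* (con 1 :+ m)) refl x m ⟩
    1 ℕ.+ x ℕ.* m ℕ.* p
      ∎)

module _ {A : Set} where

  length-unique-⇔ : {xs ys : List A} → Unique xs → Unique ys →
                    (∀ {z} → z ∈ xs ⇔ z ∈ ys) → length xs ≡ length ys
  length-unique-⇔ xs! ys! same = ↭-length (∼bag⇒↭ (unique∧set⇒bag xs! ys! same))

  length-filter-split : {P Q : Pred A 0ℓ} (P? : Decidable P) (Q? : Decidable Q) → ∀ xs →
    length (filter P? xs) ≡ length (filter (P? ∩? Q?) xs) ℕ.+ length (filter (P? ∩? ∁? Q?) xs)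
  length-filter-split P? Q? [] = refl
  length-filter-split P? Q? (x ∷ xs) with P? x | Q? x
  ... | yes _ | yes _ = cong suc (length-filter-split P? Q? xs)
  ... | yes _ | no  _ = trans (cong suc (length-filter-split P? Q? xs)) (sym (ℕ.+-suc _ _))
  ... | no  _ | yes _ = length-filter-split P? Q? xs
  ... | no  _ | no  _ = length-filter-split P? Q? xs

module FieldProperties (K : FiniteField) where
  open FiniteField K renaming (Carrier to F)
  open ≡-Reasoning

  commutativeRing : CommutativeRing 0ℓ 0ℓ
  commutativeRing = record { isCommutativeRing = isCommutativeRing }

  open CommutativeRing commutativeRing public
    using (*-assoc; *-comm; distribˡ; zeroˡ; zeroʳ; *-identityˡ; *-identityʳ; +-identityʳ; semiring)
  open RingProperties (CommutativeRing.ring commutativeRing) public using (x[y-z]≈xy-xz)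
  open GroupProperties (CommutativeRing.+-group commutativeRing) public using (identityʳ-unique)
  private
    module Exp = SemiringExp (CommutativeRing.commutativeSemiring commutativeRing)
    module Mult = SemiringMult semiring

  ^≡^ : ∀ x n → x ^ n ≡ x Exp.^ n
  ^≡^ x zero    = refl
  ^≡^ x (suc n) = cong (x *_) (^≡^ x n)

  ×1≡× : ∀ n → n ×1 ≡ n Mult.× 1#
  ×1≡× zero    = refl
  ×1≡× (suc n) = cong (1# +_) (×1≡× n)

  ^-homo-* : ∀ x m n → x ^ (m ℕ.+ n) ≡ x ^ m * x ^ n
  ^-homo-* x m n rewrite ^≡^ x (m ℕ.+ n) | ^≡^ x m | ^≡^ x n = Exp.^-homo-* x m n

  ^-assocʳ : ∀ x m n → (x ^ m) ^ n ≡ x ^ (m ℕ.* n)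
  ^-assocʳ x m n rewrite ^≡^ (x ^ m) n | ^≡^ x m | ^≡^ x (m ℕ.* n) = Exp.^-assocʳ x m n

  ×1-homo-+ : ∀ m n → (m ℕ.+ n) ×1 ≡ m ×1 + n ×1
  ×1-homo-+ m n rewrite ×1≡× (m ℕ.+ n) | ×1≡× m | ×1≡× n = Mult.×-homo-+ 1# m n

  ×1-homo-* : ∀ m n → (m ℕ.* n) ×1 ≡ m ×1 * n ×1
  ×1-homo-* m n rewrite ×1≡× (m ℕ.* n) | ×1≡× m | ×1≡× n = Mult.×1-homo-* m n

  ^-distrib-* : ∀ x y n → (x * y) ^ n ≡ x ^ n * y ^ n
  ^-distrib-* x y n rewrite ^≡^ (x * y) n | ^≡^ x n | ^≡^ y n = Exp.^-distrib-* x y n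

  1#^n≡1# : ∀ n → 1# ^ n ≡ 1#
  1#^n≡1# zero    = refl
  1#^n≡1# (suc n) = trans (*-identityˡ _) (1#^n≡1# n)

  ^-*≡1 : ∀ {x m} → x ^ m ≡ 1# → ∀ k → x ^ (k ℕ.* m) ≡ 1#
  ^-*≡1 {x} {m} x^m≡1 k = begin
    x ^ (k ℕ.* m)   ≡⟨ cong (x ^_) (ℕ.*-comm k m) ⟩
    x ^ (m ℕ.* k)   ≡⟨ sym (^-assocʳ x m k) ⟩
    (x ^ m) ^ k     ≡⟨ cong (_^ k) x^m≡1 ⟩
    1# ^ k          ≡⟨ 1#^n≡1# k ⟩
    1#              ∎

  *-cancelˡ : ∀ {x y z} → x ≢ 0# → x * y ≡ x * z → y ≡ z
  *-cancelˡ {x} {y} {z} x≢0 xy≡xz = let x⁻¹ , xx⁻¹≡1 = inverse x x≢0 in begin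
    y                ≡⟨ sym (*-identityˡ y) ⟩
    1# * y           ≡⟨ cong (_* y) (trans (sym xx⁻¹≡1) (*-comm x x⁻¹)) ⟩
    (x⁻¹ * x) * y    ≡⟨ *-assoc x⁻¹ x y ⟩
    x⁻¹ * (x * y)    ≡⟨ cong (x⁻¹ *_) xy≡xz ⟩
    x⁻¹ * (x * z)    ≡⟨ sym (*-assoc x⁻¹ x z) ⟩
    (x⁻¹ * x) * z    ≡⟨ cong (_* z) (trans (*-comm x⁻¹ x) xx⁻¹≡1) ⟩
    1# * z           ≡⟨ *-identityˡ z ⟩
    z                ∎

  *-≢0 : ∀ {x y} → x ≢ 0# → y ≢ 0# → x * y ≢ 0#
  *-≢0 {x} x≢0 y≢0 xy≡0 = y≢0 (*-cancelˡ x≢0 (trans xy≡0 (sym (zeroʳ x))))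

  ^-≢0 : ∀ {x} n → x ≢ 0# → x ^ n ≢ 0#
  ^-≢0 zero    _   1≡0 = 0≢1 (sym 1≡0)
  ^-≢0 (suc n) x≢0     = *-≢0 x≢0 (^-≢0 n x≢0)

  count : {P : Pred F 0ℓ} → Decidable P → ℕ
  count P? = length (filter P? elements)

  count-≡0⊎∃ : {P : Pred F 0ℓ} (P? : Decidable P) → count P? ≡ 0 ⊎ ∃ P
  count-≡0⊎∃ P? with any? P? elements
  ... | yes some = inj₂ (satisfied some)
  ... | no none  = inj₁ (cong length (filter-none P? (¬Any⇒All¬ elements none)))

  count-cong : {P Q : Pred F 0ℓ} (P? : Decidable P) (Q? : Decidable Q) →
               (∀ {x} → P x → Q x) → (∀ {x} → Q x → P x) → count P? ≡ count Q?
  count-cong P? Q? P⇒Q Q⇒P = cong length (filter-≐ P? Q? (P⇒Q , Q⇒P) elements)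

  open DecMembership _≟_ public using (_∈?_)

  count-∈ : {xs : List F} → Unique xs → count (_∈? xs) ≡ length xs
  count-∈ {xs} xs! = length-unique-⇔ (Unique.filter⁺ (_∈? xs) {elements} elements-unique) xs!
    (mk⇔ (proj₂ ∘ ∈-filter⁻ (_∈? xs) {xs = elements}) (∈-filter⁺ (_∈? xs) (elements-complete _)))

  count-*ˡ : ∀ {c} → c ≢ 0# → {P : Pred F 0ℓ} (P? : Decidable P) → count P? ≡ count (P? ∘ (c *_))
  count-*ˡ {c} c≢0 {P} P? = trans
    (length-unique-⇔ (Unique.filter⁺ P? {elements} elements-unique)
                     (Unique.map⁺ (*-cancelˡ c≢0) (Unique.filter⁺ (P? ∘ (c *_)) {elements} elements-unique))
                     (mk⇔ to from))
    (length-map (c *_) (filter (P? ∘ (c *_)) elements))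
    where
    c⁻¹ = proj₁ (inverse c c≢0)

    c*[c⁻¹*z]≡z : ∀ z → c * (c⁻¹ * z) ≡ z
    c*[c⁻¹*z]≡z z = trans (sym (*-assoc c c⁻¹ z)) (trans (cong (_* z) (proj₂ (inverse c c≢0))) (*-identityˡ z))

    to : ∀ {z} → z ∈ filter P? elements → z ∈ map (c *_) (filter (P? ∘ (c *_)) elements)
    to {z} z∈ = subst (_∈ _) (c*[c⁻¹*z]≡z z) (∈-map⁺ (c *_) (∈-filter⁺ (P? ∘ (c *_)) (elements-complete _)
                  (subst P (sym (c*[c⁻¹*z]≡z z)) (proj₂ (∈-filter⁻ P? {xs = elements} z∈)))))

    from : ∀ {z} → z ∈ map (c *_) (filter (P? ∘ (c *_)) elements) → z ∈ filter P? elements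
    from z∈ with x , x∈ , refl ← ∈-map⁻ (c *_) z∈ =
      ∈-filter⁺ P? (elements-complete _) (proj₂ (∈-filter⁻ (P? ∘ (c *_)) {xs = elements} x∈))

  ^-repeat⇒period : ∀ {x i j} → x ≢ 0# → i < j → x ^ i ≡ x ^ j → ∃ λ d → (0 < d × x ^ d ≡ 1#) × d ≤ j
  ^-repeat⇒period {x} {i} x≢0 i<j x^i≡x^j with o , refl ← ℕ.m≤n⇒∃[o]m+o≡n i<j =
    suc o , (s≤s z≤n , x^d≡1) , s≤s (ℕ.m≤n+m o i)
    where
    x^d≡1 : x ^ suc o ≡ 1#
    x^d≡1 = sym (*-cancelˡ (^-≢0 i x≢0) (begin
      x ^ i * 1#            ≡⟨ *-identityʳ _ ⟩
      x ^ i                 ≡⟨ x^i≡x^j ⟩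
      x ^ (suc i ℕ.+ o)     ≡⟨ cong (x ^_) (sym (ℕ.+-suc i o)) ⟩
      x ^ (i ℕ.+ suc o)     ≡⟨ ^-homo-* x i (suc o) ⟩
      x ^ i * x ^ suc o     ∎))

  position : F → Fin order
  position y = index (elements-complete y)

  position-injective : ∀ {y z} → position y ≡ position z → y ≡ z
  position-injective {y} {z} same =
    trans (lookup-index (elements-complete y)) (trans (cong (lookup elements) same) (sym (lookup-index (elements-complete z))))

  has-period : ∀ {x} → x ≢ 0# → ∃ λ d → 0 < d × x ^ d ≡ 1#
  has-period {x} x≢0 with i , j , i<j , same ← pigeonhole (ℕ.n<1+n order) (position ∘ (x ^_) ∘ toℕ) =
    map₂ proj₁ (^-repeat⇒period x≢0 i<j (position-injective same))

  IsOrder : F → ℕ → Set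
  IsOrder x = IsLeast (λ j → 0 < j × x ^ j ≡ 1#)

  order-exists : ∀ {x} → x ≢ 0# → ∃ (IsOrder x)
  order-exists {x} x≢0 = let d , period = has-period x≢0 in
    least-witness (λ j → (0 ℕ.<? j) ×-dec ((x ^ j) ≟ 1#)) {d} period

  module Orbit {e : F} {t : ℕ} (e-order : IsOrder e t) where
    private
      0<t : 0 < t
      0<t = proj₁ (proj₁ e-order)

      instance
        t≢0 : NonZero t
        t≢0 = ℕ.>-nonZero 0<t

    e^t≡1 : e ^ t ≡ 1#
    e^t≡1 = proj₂ (proj₁ e-order)

    e^[t-1]*e≡1 : e ^ ℕ.pred t * e ≡ 1#
    e^[t-1]*e≡1 = trans (*-comm _ e) (subst (λ n → e ^ n ≡ 1#) (sym (ℕ.suc-pred t)) e^t≡1)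

    e≢0 : e ≢ 0#
    e≢0 e≡0 = 0≢1 (trans (sym (zeroʳ _)) (trans (cong (e ^ ℕ.pred t *_) (sym e≡0)) e^[t-1]*e≡1))

    ^-reduce : ∀ n → e ^ n ≡ e ^ (n % t)
    ^-reduce n = begin
      e ^ n                                  ≡⟨ cong (e ^_) (m≡m%n+[m/n]*n n t) ⟩
      e ^ (n % t ℕ.+ n / t ℕ.* t)            ≡⟨ ^-homo-* e (n % t) _ ⟩
      e ^ (n % t) * e ^ (n / t ℕ.* t)        ≡⟨ cong (e ^ (n % t) *_) (^-*≡1 e^t≡1 (n / t)) ⟩
      e ^ (n % t) * 1#                       ≡⟨ *-identityʳ _ ⟩
      e ^ (n % t)                            ∎

    orbit : F → List F
    orbit x = applyUpTo (λ i → e ^ i * x) t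

    ∈-orbit : ∀ x n → e ^ n * x ∈ orbit x
    ∈-orbit x n = subst (_∈ orbit x) (cong (_* x) (sym (^-reduce n))) (∈-applyUpTo⁺ (λ i → e ^ i * x) (m%n<n n t))

    ∈-orbit-*ˡ⁻ : ∀ {x y} → e * y ∈ orbit x → y ∈ orbit x
    ∈-orbit-*ˡ⁻ {x} {y} ey∈ with i , _ , ey≡e^i*x ← ∈-applyUpTo⁻ (λ i → e ^ i * x) ey∈ =
      subst (_∈ orbit x) y≡ (∈-orbit x (ℕ.pred t ℕ.+ i))
      where
      y≡ : e ^ (ℕ.pred t ℕ.+ i) * x ≡ y
      y≡ = begin
        e ^ (ℕ.pred t ℕ.+ i) * x        ≡⟨ cong (_* x) (^-homo-* e (ℕ.pred t) i) ⟩
        (e ^ ℕ.pred t * e ^ i) * x      ≡⟨ *-assoc _ _ x ⟩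
        e ^ ℕ.pred t * (e ^ i * x)      ≡⟨ cong (e ^ ℕ.pred t *_) (sym ey≡e^i*x) ⟩
        e ^ ℕ.pred t * (e * y)          ≡⟨ sym (*-assoc _ e y) ⟩
        (e ^ ℕ.pred t * e) * y          ≡⟨ cong (_* y) e^[t-1]*e≡1 ⟩
        1# * y                          ≡⟨ *-identityˡ y ⟩
        y                               ∎

    orbit-unique : ∀ {x} → x ≢ 0# → Unique (orbit x)
    orbit-unique {x} x≢0 = Unique.applyUpTo⁺₁ (λ i → e ^ i * x) t distinct
      where
      distinct : ∀ {i j} → i < j → j < t → e ^ i * x ≢ e ^ j * x
      distinct i<j j<t same
        with d , period , d≤j ← ^-repeat⇒period e≢0 i<j
               (*-cancelˡ x≢0 (trans (*-comm x _) (trans same (*-comm _ x)))) =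
        proj₂ e-order (ℕ.≤-<-trans d≤j j<t) period

    module RemoveOrbit {P : Pred F 0ℓ} (P? : Decidable P)
             (nonzero : ∀ {y} → P y → y ≢ 0#) (closed : ∀ {y} → P y → P (e * y))
             {x : F} (Px : P x) where

      Outside : Pred F 0ℓ
      Outside y = P y × y ∉ orbit x

      outside? : Decidable Outside
      outside? = P? ∩? ∁? (_∈? orbit x)

      orbit⊆P : ∀ {y} → y ∈ orbit x → P y
      orbit⊆P y∈ with i , _ , refl ← ∈-applyUpTo⁻ (λ i → e ^ i * x) y∈ = P[e^i*x] i
        where
        P[e^i*x] : ∀ i → P (e ^ i * x)
        P[e^i*x] zero    = subst P (sym (*-identityˡ x)) Px
        P[e^i*x] (suc i) = subst P (sym (*-assoc e (e ^ i) x)) (closed (P[e^i*x] i))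

      count-≡-t+outside : count P? ≡ t ℕ.+ count outside?
      count-≡-t+outside = begin
        count P?                                             ≡⟨ length-filter-split P? (_∈? orbit x) elements ⟩
        count (P? ∩? (_∈? orbit x)) ℕ.+ count outside?       ≡⟨ cong (ℕ._+ count outside?) count-orbit ⟩
        t ℕ.+ count outside?                                 ∎
        where
        count-orbit : count (P? ∩? (_∈? orbit x)) ≡ t
        count-orbit = begin
          count (P? ∩? (_∈? orbit x))   ≡⟨ count-cong _ (_∈? orbit x) proj₂ (λ y∈ → orbit⊆P y∈ , y∈) ⟩
          count (_∈? orbit x)           ≡⟨ count-∈ (orbit-unique (nonzero Px)) ⟩
          length (orbit x)              ≡⟨ length-applyUpTo (λ i → e ^ i * x) t ⟩
          t                             ∎

      outside-closed : ∀ {y} → Outside y → Outside (e * y)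
      outside-closed (Py , y∉) = closed Py , y∉ ∘ ∈-orbit-*ˡ⁻

    -- Peel off the orbit of some x with P x: it has exactly t elements, and the rest of P is still
    -- closed under e *_.
    order-∣-count : {P : Pred F 0ℓ} (P? : Decidable P) →
                    (∀ {y} → P y → y ≢ 0#) → (∀ {y} → P y → P (e * y)) → t ∣ count P?
    order-∣-count P? = go P? (<-wellFounded _)
      where
      go : {P : Pred F 0ℓ} (P? : Decidable P) → Acc _<_ (count P?) →
           (∀ {y} → P y → y ≢ 0#) → (∀ {y} → P y → P (e * y)) → t ∣ count P?
      go P? (acc smaller) nonzero closed with count-≡0⊎∃ P?
      ... | inj₁ none       = subst (t ∣_) (sym none) (t ∣0)
      ... | inj₂ (x , Px) =
        subst (t ∣_) (sym count-≡-t+outside)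
          (∣m∣n⇒∣m+n ∣-refl (go outside? (smaller fewer) (nonzero ∘ proj₁) outside-closed))
        where
        open RemoveOrbit P? nonzero closed Px
        fewer : count outside? < count P?
        fewer = subst (count outside? <_) (sym count-≡-t+outside) (ℕ.m<n+m (count outside?) 0<t)

  ∃-root : ∀ {m s x} → x ≢ 0# → x ^ m ≡ 1# → Coprime s m → ∃ λ y → y ≢ 0# × y ^ s ≡ x
  ∃-root {m} {s} {x} x≢0 x^m≡1 s⊥m with coprime-Bézout s⊥m
  ... | Bézout.+- u v eq = x ^ u , ^-≢0 u x≢0 , (begin
    (x ^ u) ^ s              ≡⟨ ^-assocʳ x u s ⟩
    x ^ (u ℕ.* s)            ≡⟨ cong (x ^_) (sym eq) ⟩
    x ^ suc (v ℕ.* m)        ≡⟨ cong (x *_) (^-*≡1 x^m≡1 v) ⟩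
    x * 1#                   ≡⟨ *-identityʳ x ⟩
    x                        ∎)
  ... | Bézout.-+ u v eq = w⁻¹ , w⁻¹≢0 , (begin
    w⁻¹ ^ s                      ≡⟨ sym (*-identityʳ _) ⟩
    w⁻¹ ^ s * 1#                 ≡⟨ cong (w⁻¹ ^ s *_) (sym w^s*x≡1) ⟩
    w⁻¹ ^ s * (w ^ s * x)        ≡⟨ sym (*-assoc _ _ x) ⟩
    (w⁻¹ ^ s * w ^ s) * x        ≡⟨ cong (_* x) (sym (^-distrib-* w⁻¹ w s)) ⟩
    (w⁻¹ * w) ^ s * x            ≡⟨ cong (λ y → y ^ s * x) (trans (*-comm w⁻¹ w) ww⁻¹≡1) ⟩
    1# ^ s * x                   ≡⟨ cong (_* x) (1#^n≡1# s) ⟩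
    1# * x                       ≡⟨ *-identityˡ x ⟩
    x                            ∎)
    where
    w = x ^ u
    w⁻¹ = proj₁ (inverse w (^-≢0 u x≢0))
    ww⁻¹≡1 : w * w⁻¹ ≡ 1#
    ww⁻¹≡1 = proj₂ (inverse w (^-≢0 u x≢0))
    w⁻¹≢0 : w⁻¹ ≢ 0#
    w⁻¹≢0 w⁻¹≡0 = 0≢1 (trans (sym (zeroʳ w)) (trans (cong (w *_) (sym w⁻¹≡0)) ww⁻¹≡1))
    w^s*x≡1 : w ^ s * x ≡ 1#
    w^s*x≡1 = begin
      w ^ s * x            ≡⟨ cong (_* x) (^-assocʳ x u s) ⟩
      x ^ (u ℕ.* s) * x    ≡⟨ *-comm _ x ⟩
      x ^ suc (u ℕ.* s)    ≡⟨ cong (x ^_) eq ⟩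
      x ^ (v ℕ.* m)        ≡⟨ ^-*≡1 x^m≡1 v ⟩
      1#                   ∎

  ^-p^i : ∀ {p a} → a ^ p ≡ a → ∀ i → a ^ (p ℕ.^ i) ≡ a
  ^-p^i {p} {a} a^p≡a zero    = *-identityʳ a
  ^-p^i {p} {a} a^p≡a (suc i) = begin
    a ^ (p ℕ.* p ℕ.^ i)     ≡⟨ sym (^-assocʳ a p (p ℕ.^ i)) ⟩
    (a ^ p) ^ (p ℕ.^ i)     ≡⟨ cong (_^ (p ℕ.^ i)) a^p≡a ⟩
    a ^ (p ℕ.^ i)           ≡⟨ ^-p^i a^p≡a i ⟩
    a                       ∎

  Tr-*ˡ : ∀ {p a} → a ^ p ≡ a → ∀ n s z → WeilSums.Tr K p n s (a * z) ≡ a * WeilSums.Tr K p n s z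
  Tr-*ˡ {p} {a} a^p≡a zero    s z = sym (zeroʳ a)
  Tr-*ˡ {p} {a} a^p≡a (suc n) s z = begin
    (a * z) ^ (p ℕ.^ n) + Tr n (a * z)            ≡⟨ cong₂ _+_ (^-distrib-* a z (p ℕ.^ n)) (Tr-*ˡ a^p≡a n s z) ⟩
    a ^ (p ℕ.^ n) * z ^ (p ℕ.^ n) + a * Tr n z    ≡⟨ cong (λ b → b * z ^ (p ℕ.^ n) + a * Tr n z) (^-p^i a^p≡a n) ⟩
    a * z ^ (p ℕ.^ n) + a * Tr n z                ≡⟨ sym (distribˡ a _ _) ⟩
    a * (z ^ (p ℕ.^ n) + Tr n z)                  ∎
    where
    Tr : ℕ → F → F
    Tr n = WeilSums.Tr K p n s

module PrimeField (K : FiniteField) (p-1 : ℕ) (p-prime : Prime (suc p-1))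
                  (char : FiniteField._×1 K (suc p-1) ≡ FiniteField.0# K) where
  open FiniteField K renaming (Carrier to F)
  open FieldProperties K
  open ≡-Reasoning

  p : ℕ
  p = suc p-1

  ×1-mod : ∀ a → (a % p) ×1 ≡ a ×1
  ×1-mod a = sym (begin
    a ×1                                ≡⟨ cong _×1 (m≡m%n+[m/n]*n a p) ⟩
    (a % p ℕ.+ a / p ℕ.* p) ×1          ≡⟨ ×1-homo-+ (a % p) _ ⟩
    (a % p) ×1 + (a / p ℕ.* p) ×1       ≡⟨ cong ((a % p) ×1 +_) (×1-homo-* (a / p) p) ⟩
    (a % p) ×1 + (a / p) ×1 * p ×1      ≡⟨ cong (λ z → (a % p) ×1 + (a / p) ×1 * z) char ⟩
    (a % p) ×1 + (a / p) ×1 * 0#        ≡⟨ cong ((a % p) ×1 +_) (zeroʳ _) ⟩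
    (a % p) ×1 + 0#                     ≡⟨ +-identityʳ _ ⟩
    (a % p) ×1                          ∎)

  ×1-*-mod : ∀ a b → a ×1 * b ×1 ≡ ((a ℕ.* b) % p) ×1
  ×1-*-mod a b = trans (sym (×1-homo-* a b)) (sym (×1-mod (a ℕ.* b)))

  ×1-≢0 : ∀ {a} → 0 < a → a < p → a ×1 ≢ 0#
  ×1-≢0 {a} 0<a a<p a≡0 = 0≢1 (begin
    0#                        ≡⟨ sym (zeroˡ _) ⟩
    0# * b ×1                 ≡⟨ cong (_* b ×1) (sym a≡0) ⟩
    a ×1 * b ×1               ≡⟨ ×1-*-mod a b ⟩
    ((a ℕ.* b) % p) ×1        ≡⟨ cong _×1 ab≡1 ⟩
    1 ×1                      ≡⟨ +-identityʳ 1# ⟩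
    1#                        ∎)
    where
    b = proj₁ (mod-inverse p-prime {{ℕ.>-nonZero 0<a}} a<p)
    ab≡1 = proj₂ (mod-inverse p-prime {{ℕ.>-nonZero 0<a}} a<p)

  ×1-distinct : ∀ {i j} → i < j → j < p → i ×1 ≢ j ×1
  ×1-distinct {i} i<j j<p i≡j with d , refl ← ℕ.m≤n⇒∃[o]m+o≡n i<j =
    ×1-≢0 (s≤s z≤n) (ℕ.≤-<-trans (s≤s (ℕ.m≤n+m d i)) j<p) (identityʳ-unique (i ×1) (suc d ×1) (begin
      i ×1 + suc d ×1         ≡⟨ sym (×1-homo-+ i (suc d)) ⟩
      (i ℕ.+ suc d) ×1        ≡⟨ cong _×1 (ℕ.+-suc i d) ⟩
      (suc i ℕ.+ d) ×1        ≡⟨ sym i≡j ⟩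
      i ×1                    ∎))

  units : List F
  units = applyUpTo (λ i → suc i ×1) p-1

  units-unique : Unique units
  units-unique = Unique.applyUpTo⁺₁ _ p-1 (λ i<j j<p-1 → ×1-distinct (s≤s i<j) (s≤s j<p-1))

  units-≢0 : ∀ {y} → y ∈ units → y ≢ 0#
  units-≢0 y∈ with i , i<p-1 , refl ← ∈-applyUpTo⁻ _ y∈ = ×1-≢0 (s≤s z≤n) (s≤s i<p-1)

  units-closed : ∀ {g} → 0 < g → g < p → ∀ {y} → y ∈ units → g ×1 * y ∈ units
  units-closed {g} 0<g g<p y∈ with i , i<p-1 , refl ← ∈-applyUpTo⁻ _ y∈
    with (g ℕ.* suc i) % p in r≡ | m%n<n (g ℕ.* suc i) p
  ... | zero  | _   = contradiction (trans (×1-*-mod g (suc i)) (cong _×1 r≡))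
                        (*-≢0 (×1-≢0 0<g g<p) (×1-≢0 (s≤s z≤n) (s≤s i<p-1)))
  ... | suc r | r<p = subst (_∈ units) (sym (trans (×1-*-mod g (suc i)) (cong _×1 r≡)))
                        (∈-applyUpTo⁺ _ (ℕ.≤-pred r<p))

  -- Multiplication by g ×1 permutes the units 1 ×1, …, (p − 1) ×1, so its order divides p − 1.
  fermat : ∀ {g} → 0 < g → g < p → (g ×1) ^ p-1 ≡ 1#
  fermat {g} 0<g g<p with t , a-order ← order-exists (×1-≢0 0<g g<p)
    with divides k p-1≡k*t ← Orbit.order-∣-count a-order (_∈? units) units-≢0 (units-closed 0<g g<p) = begin
    (g ×1) ^ p-1                     ≡⟨ cong ((g ×1) ^_) (length-applyUpTo _ p-1) ⟨
    (g ×1) ^ length units            ≡⟨ cong ((g ×1) ^_) (count-∈ units-unique) ⟨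
    (g ×1) ^ count (_∈? units)       ≡⟨ cong ((g ×1) ^_) p-1≡k*t ⟩
    (g ×1) ^ (k ℕ.* t)               ≡⟨ ^-*≡1 (Orbit.e^t≡1 a-order) k ⟩
    1#                               ∎

  frobenius : ∀ {g} → 0 < g → g < p → (g ×1) ^ p ≡ g ×1
  frobenius 0<g g<p = trans (cong (_ *_) (fermat 0<g g<p)) (*-identityʳ _)

module _ {p : ℕ} where
  open ℤ-Solver.+-*-Solver
  open ≡-Reasoning

  ≈ζ-refl : {a : ℤ[ζ] p} → a ≈ζ a
  ≈ζ-refl {a} i j = trans (ℤ.+-inverseʳ (a i)) (sym (ℤ.+-inverseʳ (a j)))

  ≈ζ-sym : {a b : ℤ[ζ] p} → a ≈ζ b → b ≈ζ a
  ≈ζ-sym {a} {b} a≈b i j = begin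
    b i ℤ.- a i          ≡⟨ solve 2 (λ x y → y :- x := :- (x :- y)) refl (a i) (b i) ⟩
    ℤ.- (a i ℤ.- b i)    ≡⟨ cong ℤ.-_ (a≈b i j) ⟩
    ℤ.- (a j ℤ.- b j)    ≡⟨ solve 2 (λ x y → :- (x :- y) := y :- x) refl (a j) (b j) ⟩
    b j ℤ.- a j          ∎

  ≈ζ-trans : {a b c : ℤ[ζ] p} → a ≈ζ b → b ≈ζ c → a ≈ζ c
  ≈ζ-trans {a} {b} {c} a≈b b≈c i j = begin
    a i ℤ.- c i                          ≡⟨ solve 3 (λ x y z → x :- z := (x :- y) :+ (y :- z)) refl (a i) (b i) (c i) ⟩
    (a i ℤ.- b i) ℤ.+ (b i ℤ.- c i)      ≡⟨ cong₂ ℤ._+_ (a≈b i j) (b≈c i j) ⟩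
    (a j ℤ.- b j) ℤ.+ (b j ℤ.- c j)      ≡⟨ solve 3 (λ x y z → (x :- y) :+ (y :- z) := x :- z) refl (a j) (b j) (c j) ⟩
    a j ℤ.- c j                          ∎

  ≗⇒≈ζ : {a b : ℤ[ζ] p} → (∀ i → a i ≡ b i) → a ≈ζ b
  ≗⇒≈ζ {a} {b} a≗b i j rewrite a≗b i | a≗b j = ≈ζ-refl {b} i j

ℤ[ζ]-setoid : ℕ → Setoid 0ℓ 0ℓ
ℤ[ζ]-setoid p = record
  { Carrier       = ℤ[ζ] p
  ; _≈_           = _≈ζ_
  ; isEquivalence = record
    { refl  = λ {a} → ≈ζ-refl {a = a}
    ; sym   = λ {a b} → ≈ζ-sym {a = a} {b}
    ; trans = λ {a b c} → ≈ζ-trans {a = a} {b} {c}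
    }
  }

module ≈ζ-Reasoning {p : ℕ} = SetoidReasoning (ℤ[ζ]-setoid p)

sumℤ-single : ∀ {n} (c : Fin n → ℤ) {j} → (∀ j′ → j′ ≢ j → c j′ ≡ 0ℤ) →
              ∀ {xs} → Unique xs → j ∈ xs → sumℤ (map c xs) ≡ c j
sumℤ-single c {j} vanish = go
  where
  zeros : ∀ {xs} → All (_≢ j) xs → sumℤ (map c xs) ≡ 0ℤ
  zeros []           = refl
  zeros (x≢j ∷ rest) = cong₂ ℤ._+_ (vanish _ x≢j) (zeros rest)

  go : ∀ {xs} → Unique xs → j ∈ xs → sumℤ (map c xs) ≡ c j
  go (x∉xs ∷ _) (here refl) =
    trans (cong (λ z → c j ℤ.+ z) (zeros (All.map (λ j≢x → j≢x ∘ sym) x∉xs))) (ℤ.+-identityʳ (c j))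
  go {x ∷ _} (x∉xs ∷ xs!) (there j∈) =
    trans (cong₂ ℤ._+_ (vanish x λ { refl → All.lookup x∉xs j∈ refl }) (go xs! j∈)) (ℤ.+-identityˡ _)

module _ {p : ℕ} (γ : ℕ) (a : ℤ[ζ] p) (i : Fin p) where

  -- The coefficient function in the definition of σ is local to Defs; this names it, and a `with`
  -- on the same test as in Defs then evaluates it.
  σ-as-sum : Σ (Fin p → ℤ) λ c → σ γ a i ≡ sumℤ (map c (allFin p))
  σ-as-sum = _ , refl

  private
    c = proj₁ σ-as-sum

    c-hit : ∀ j → toℕ i ≡ modℕ (γ ℕ.* toℕ j) p → c j ≡ a j
    c-hit j hit with toℕ i ℕ.≟ modℕ (γ ℕ.* toℕ j) p
    ... | yes _   = refl
    ... | no miss = contradiction hit miss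

    c-miss : ∀ j → toℕ i ≢ modℕ (γ ℕ.* toℕ j) p → c j ≡ 0ℤ
    c-miss j miss with toℕ i ℕ.≟ modℕ (γ ℕ.* toℕ j) p
    ... | yes hit = contradiction hit miss
    ... | no _    = refl

  σ-apply : ∀ j → toℕ i ≡ modℕ (γ ℕ.* toℕ j) p →
            (∀ j′ → toℕ i ≡ modℕ (γ ℕ.* toℕ j′) p → j′ ≡ j) → σ γ a i ≡ a j
  σ-apply j hit unique = begin
    σ γ a i                       ≡⟨ proj₂ σ-as-sum ⟩
    sumℤ (map c (allFin p))       ≡⟨ sumℤ-single c (λ j′ j′≢j → c-miss j′ (j′≢j ∘ unique j′)) (Unique.allFin⁺ p) (∈-allFin j) ⟩
    c j                           ≡⟨ c-hit j hit ⟩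
    a j                           ∎
    where open ≡-Reasoning

module GaloisAction (p-1 : ℕ) (p-prime : Prime (suc p-1)) (γ : ℕ) (0<γ : 0 < γ) (γ<p : γ < suc p-1) where

  private
    p : ℕ
    p = suc p-1

    instance
      γ≢0 : NonZero γ
      γ≢0 = ℕ.>-nonZero 0<γ

  -- Opaque, so that type checking never unfolds the Bézout computation behind it.
  opaque
    γ⁻¹ : ℕ
    γ⁻¹ = proj₁ (mod-inverse p-prime γ<p)

    γγ⁻¹≡1 : (γ ℕ.* γ⁻¹) % p ≡ 1
    γγ⁻¹≡1 = proj₂ (mod-inverse p-prime γ<p)

  γ⁻¹γ≡1 : (γ⁻¹ ℕ.* γ) % p ≡ 1
  γ⁻¹γ≡1 = trans (cong (_% p) (ℕ.*-comm γ⁻¹ γ)) γγ⁻¹≡1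

  γ⁻¹·_ : Fin p → Fin p
  γ⁻¹· i = fromℕ< (m%n<n (γ⁻¹ ℕ.* toℕ i) p)

  γ·γ⁻¹· : ∀ i → toℕ i ≡ (γ ℕ.* toℕ (γ⁻¹· i)) % p
  γ·γ⁻¹· i = sym (begin
    (γ ℕ.* toℕ (γ⁻¹· i)) % p              ≡⟨ cong (λ z → (γ ℕ.* z) % p) (toℕ-fromℕ< _) ⟩
    (γ ℕ.* ((γ⁻¹ ℕ.* toℕ i) % p)) % p     ≡⟨ *-inverse-%-cancel γ γ⁻¹ (toℕ i) γγ⁻¹≡1 ⟩
    toℕ i % p                             ≡⟨ m<n⇒m%n≡m (toℕ<n i) ⟩
    toℕ i                                 ∎)
    where open ≡-Reasoning

  γ⁻¹·-unique : ∀ i j → toℕ i ≡ (γ ℕ.* toℕ j) % p → j ≡ γ⁻¹· i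
  γ⁻¹·-unique i j i≡γj = toℕ-injective (begin
    toℕ j                                 ≡⟨ sym (m<n⇒m%n≡m (toℕ<n j)) ⟩
    toℕ j % p                             ≡⟨ sym (*-inverse-%-cancel γ⁻¹ γ (toℕ j) γ⁻¹γ≡1) ⟩
    (γ⁻¹ ℕ.* ((γ ℕ.* toℕ j) % p)) % p     ≡⟨ cong (λ z → (γ⁻¹ ℕ.* z) % p) (sym i≡γj) ⟩
    (γ⁻¹ ℕ.* toℕ i) % p                   ≡⟨ sym (toℕ-fromℕ< _) ⟩
    toℕ (γ⁻¹· i)                          ∎)
    where open ≡-Reasoning

  γ⁻¹·-surjective : ∀ j → ∃ λ i → γ⁻¹· i ≡ j
  γ⁻¹·-surjective j = i , sym (γ⁻¹·-unique i j (toℕ-fromℕ< (m%n<n (γ ℕ.* toℕ j) p)))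
    where i = fromℕ< (m%n<n (γ ℕ.* toℕ j) p)

  σ-formula : ∀ (v : ℤ[ζ] p) i → σ γ v i ≡ v (γ⁻¹· i)
  σ-formula v i = σ-apply γ v i (γ⁻¹· i) (γ·γ⁻¹· i) (γ⁻¹·-unique i)

  σ-cong : ∀ {v w : ℤ[ζ] p} → v ≈ζ w → σ γ v ≈ζ σ γ w
  σ-cong {v} {w} v≈w i j rewrite σ-formula v i | σ-formula w i | σ-formula v j | σ-formula w j =
    v≈w (γ⁻¹· i) (γ⁻¹· j)

  σ-injective : ∀ {v w : ℤ[ζ] p} → σ γ v ≈ζ σ γ w → v ≈ζ w
  σ-injective {v} {w} σv≈σw i j with i′ , refl ← γ⁻¹·-surjective i | j′ , refl ← γ⁻¹·-surjective j
    rewrite sym (σ-formula v i′) | sym (σ-formula w i′) | sym (σ-formula v j′) | sym (σ-formula w j′) =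
    σv≈σw i′ j′

  σ^-cong : ∀ k {v w : ℤ[ζ] p} → v ≈ζ w → σ^ γ k v ≈ζ σ^ γ k w
  σ^-cong zero    v≈w = v≈w
  σ^-cong (suc k) v≈w = σ-cong (σ^-cong k v≈w)

  σ^-+ : ∀ k l (v : ℤ[ζ] p) → σ^ γ (k ℕ.+ l) v ≡ σ^ γ k (σ^ γ l v)
  σ^-+ zero    l v = refl
  σ^-+ (suc k) l v = cong (σ γ) (σ^-+ k l v)

module WeilSumsUnderσ (K : FiniteField) (p-1 : ℕ) (p-prime : Prime (suc p-1))
                      (char : FiniteField._×1 K (suc p-1) ≡ FiniteField.0# K)
                      (n s : ℕ) (s⊥p-1 : Coprime s p-1)
                      (γ : ℕ) (0<γ : 0 < γ) (γ<p : γ < suc p-1) where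
  open FiniteField K renaming (Carrier to F)
  open FieldProperties K
  open PrimeField K p-1 p-prime char
  open WeilSums K p n s
  open GaloisAction p-1 p-prime γ 0<γ γ<p public

  a : F
  a = γ ×1

  a≢0 : a ≢ 0#
  a≢0 = ×1-≢0 0<γ γ<p

  -- Opaque for the same reason as γ⁻¹.
  opaque
    b : F
    b = proj₁ (∃-root a≢0 (fermat 0<γ γ<p) s⊥p-1)

    b≢0 : b ≢ 0#
    b≢0 = proj₁ (proj₂ (∃-root a≢0 (fermat 0<γ γ<p) s⊥p-1))

    b^s≡a : b ^ s ≡ a
    b^s≡a = proj₂ (proj₂ (∃-root a≢0 (fermat 0<γ γ<p) s⊥p-1))

  b⁻¹ : F
  b⁻¹ = proj₁ (inverse b b≢0)

  -- The multiplier γ^(1 - 1/s) of the paper, computed in K as a / b with b^s = a.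
  c : F
  c = a * b⁻¹

  c*b≡a : c * b ≡ a
  c*b≡a = begin
    (a * b⁻¹) * b    ≡⟨ *-assoc a b⁻¹ b ⟩
    a * (b⁻¹ * b)    ≡⟨ cong (a *_) (trans (*-comm b⁻¹ b) (proj₂ (inverse b b≢0))) ⟩
    a * 1#           ≡⟨ *-identityʳ a ⟩
    a                ∎
    where open ≡-Reasoning

  c≢0 : c ≢ 0#
  c≢0 c≡0 = a≢0 (trans (sym c*b≡a) (trans (cong (_* b) c≡0) (zeroˡ b)))

  summand : F → F → F
  summand u x = (x ^ s) - (u * x)

  summand-scale : ∀ u x → summand (c * u) (b * x) ≡ a * summand u x
  summand-scale u x = begin
    ((b * x) ^ s) - ((c * u) * (b * x))    ≡⟨ cong₂ _-_ (trans (^-distrib-* b x s) (cong (_* x ^ s) b^s≡a)) cub≡a*ux ⟩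
    (a * x ^ s) - (a * (u * x))            ≡⟨ x[y-z]≈xy-xz a (x ^ s) (u * x) ⟨
    a * ((x ^ s) - (u * x))                ∎
    where
    open ≡-Reasoning
    cub≡a*ux : (c * u) * (b * x) ≡ a * (u * x)
    cub≡a*ux = begin
      (c * u) * (b * x)    ≡⟨ cong (_* (b * x)) (*-comm c u) ⟩
      (u * c) * (b * x)    ≡⟨ *-assoc u c (b * x) ⟩
      u * (c * (b * x))    ≡⟨ cong (u *_) (*-assoc c b x) ⟨
      u * ((c * b) * x)    ≡⟨ cong (λ y → u * (y * x)) c*b≡a ⟩
      u * (a * x)          ≡⟨ *-assoc u a x ⟨
      (u * a) * x          ≡⟨ cong (_* x) (*-comm u a) ⟩
      (a * u) * x          ≡⟨ *-assoc a u x ⟩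
      a * (u * x)          ∎

  W-*c : ∀ u i → W (c * u) i ≡ W u (γ⁻¹· i)
  W-*c u i = cong ℤ.+_ (trans (count-*ˡ b≢0 (λ y → Tr (summand (c * u) y) ≟ (toℕ i ×1)))
                              (count-cong _ _ (*-cancelˡ a≢0 ∘ scaled) unscaled))
    where
    i×1≡a*j×1 : toℕ i ×1 ≡ a * toℕ (γ⁻¹· i) ×1
    i×1≡a*j×1 = trans (cong _×1 (γ·γ⁻¹· i)) (sym (×1-*-mod γ (toℕ (γ⁻¹· i))))

    Tr-scale : ∀ x → Tr (summand (c * u) (b * x)) ≡ a * Tr (summand u x)
    Tr-scale x = trans (cong Tr (summand-scale u x)) (Tr-*ˡ (frobenius 0<γ γ<p) n s _)

    scaled : ∀ {x} → Tr (summand (c * u) (b * x)) ≡ toℕ i ×1 → a * Tr (summand u x) ≡ a * toℕ (γ⁻¹· i) ×1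
    scaled {x} eq = trans (sym (Tr-scale x)) (trans eq i×1≡a*j×1)

    unscaled : ∀ {x} → Tr (summand u x) ≡ toℕ (γ⁻¹· i) ×1 → Tr (summand (c * u) (b * x)) ≡ toℕ i ×1
    unscaled {x} eq = trans (Tr-scale x) (trans (cong (a *_) eq) (sym i×1≡a*j×1))

  W-*c≈σW : ∀ u → W (c * u) ≈ζ σ γ (W u)
  W-*c≈σW u = ≗⇒≈ζ λ i → trans (W-*c u i) (sym (σ-formula (W u) i))

  σ^-W : ∀ k u i → σ^ γ k (W u) i ≡ W (c ^ k * u) i
  σ^-W zero    u i = cong (λ x → W x i) (sym (*-identityˡ u))
  σ^-W (suc k) u i = begin
    σ γ (σ^ γ k (W u)) i          ≡⟨ σ-formula (σ^ γ k (W u)) i ⟩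
    σ^ γ k (W u) (γ⁻¹· i)         ≡⟨ σ^-W k u (γ⁻¹· i) ⟩
    W (c ^ k * u) (γ⁻¹· i)        ≡⟨ sym (W-*c (c ^ k * u) i) ⟩
    W (c * (c ^ k * u)) i         ≡⟨ cong (λ x → W x i) (sym (*-assoc c (c ^ k) u)) ⟩
    W (c ^ suc k * u) i           ∎
    where open ≡-Reasoning

  N-cong : ∀ {A B} → A ≈ζ B → N A ≡ N B
  N-cong {A} {B} A≈B = count-cong _ _
    (λ (u≢0 , Wu≈A) → u≢0 , ≈ζ-trans {a = W _} {A} {B} Wu≈A A≈B)
    (λ (u≢0 , Wu≈B) → u≢0 , ≈ζ-trans {a = W _} {B} {A} Wu≈B (≈ζ-sym {a = A} A≈B))

  N-σ : ∀ A → N (σ γ A) ≡ N A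
  N-σ A = trans (count-*ˡ c≢0 (λ u → ¬? (u ≟ 0#) ×-dec (W u ≈ζ? σ γ A))) (count-cong _ _ to from)
    where
    to : ∀ {u} → (c * u ≢ 0# × W (c * u) ≈ζ σ γ A) → (u ≢ 0# × W u ≈ζ A)
    to {u} (cu≢0 , Wcu≈σA) = (λ u≡0 → cu≢0 (trans (cong (c *_) u≡0) (zeroʳ c))) ,
      σ-injective (begin σ γ (W u) ≈⟨ W-*c≈σW u ⟨ W (c * u) ≈⟨ Wcu≈σA ⟩ σ γ A ∎)
      where open ≈ζ-Reasoning
    from : ∀ {u} → (u ≢ 0# × W u ≈ζ A) → (c * u ≢ 0# × W (c * u) ≈ζ σ γ A)
    from {u} (u≢0 , Wu≈A) = *-≢0 c≢0 u≢0 ,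
      (begin W (c * u) ≈⟨ W-*c≈σW u ⟩ σ γ (W u) ≈⟨ σ-cong Wu≈A ⟩ σ γ A ∎)
      where open ≈ζ-Reasoning

module TauCycle (K : FiniteField) (p-1 : ℕ) (p-prime : Prime (suc p-1))
                (char : FiniteField._×1 K (suc p-1) ≡ FiniteField.0# K)
                (n s : ℕ) (s⊥p-1 : Coprime s p-1)
                (γ : ℕ) (0<γ : 0 < γ) (γ<p : γ < suc p-1)
                (m : ℕ) (τ-order : WeilSums.τHasOrder K (suc p-1) n s γ m)
                (k : ℕ) .{{_ : NonZero k}} (A : ℕ → ℤ[ζ] (suc p-1))
                (A-in-W : ∀ i → i < k → WeilSums.InW K (suc p-1) n s (A i))
                (A-distinct : ∀ i j → i < k → j < k → i ≢ j → ¬ (A i ≈ζ A j))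
                (A-cycle : ∀ i → i < k → σ γ (A i) ≈ζ A ((i ℕ.+ 1) % k)) where
  open FiniteField K renaming (Carrier to F)
  open FieldProperties K
  open WeilSums K (suc p-1) n s
  open WeilSumsUnderσ K p-1 p-prime char n s s⊥p-1 γ 0<γ γ<p

  FixesW : ℕ → Set
  FixesW j = ∀ B → InW B → σ^ γ j B ≈ζ B

  private
    0<k : 0 < k
    0<k = ℕ.>-nonZero⁻¹ k

  τ-order-least : IsLeast (λ j → 0 < j × FixesW j) m
  τ-order-least = let 0<m , fixes , minimal = τ-order in
    (0<m , fixes) , λ j<m (0<j , fixes-j) → minimal _ 0<j j<m fixes-j

  FixesW⇒m∣ : ∀ {r} → FixesW r → m ∣ r
  FixesW⇒m∣ = least-period-∣ +-closed ∸-closed τ-order-least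
    where
    +-closed : ∀ i j → FixesW i → FixesW j → FixesW (i ℕ.+ j)
    +-closed i j fixes-i fixes-j B B∈W rewrite σ^-+ i j B =
      begin
        σ^ γ i (σ^ γ j B)     ≈⟨ σ^-cong i (fixes-j B B∈W) ⟩
        σ^ γ i B              ≈⟨ fixes-i B B∈W ⟩
        B                     ∎
      where open ≈ζ-Reasoning
    ∸-closed : ∀ i j → FixesW (i ℕ.+ j) → FixesW j → FixesW i
    ∸-closed i j fixes-i+j fixes-j B B∈W =
      begin
        σ^ γ i B              ≈⟨ σ^-cong i (fixes-j B B∈W) ⟨
        σ^ γ i (σ^ γ j B)     ≡⟨ σ^-+ i j B ⟨
        σ^ γ (i ℕ.+ j) B      ≈⟨ fixes-i+j B B∈W ⟩
        B                     ∎
      where open ≈ζ-Reasoning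

  σ^-A₀ : ∀ r → σ^ γ r (A 0) ≈ζ A (r % k)
  σ^-A₀ zero    = subst (λ j → A 0 ≈ζ A j) (sym (m<n⇒m%n≡m 0<k)) (≈ζ-refl {a = A 0})
  σ^-A₀ (suc r) = begin
    σ γ (σ^ γ r (A 0))      ≈⟨ σ-cong (σ^-A₀ r) ⟩
    σ γ (A (r % k))         ≈⟨ A-cycle (r % k) (m%n<n r k) ⟩
    A ((r % k ℕ.+ 1) % k)   ≡⟨ cong A ([m%n+1]%n≡[1+m]%n r k) ⟩
    A (suc r % k)           ∎
    where open ≈ζ-Reasoning

  k∣m : k ∣ m
  k∣m with m % k ℕ.≟ 0
  ... | yes m%k≡0 = m%n≡0⇒n∣m m k m%k≡0
  ... | no  m%k≢0 = contradiction A[m%k]≈A₀ (A-distinct (m % k) 0 (m%n<n m k) 0<k m%k≢0)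
    where
    open ≈ζ-Reasoning
    A[m%k]≈A₀ : A (m % k) ≈ζ A 0
    A[m%k]≈A₀ = begin
      A (m % k)         ≈⟨ σ^-A₀ m ⟨
      σ^ γ m (A 0)      ≈⟨ proj₁ (proj₂ τ-order) (A 0) (A-in-W 0 0<k) ⟩
      A 0               ∎

  N-A≡N-A₀ : ∀ i → i < k → N (A i) ≡ N (A 0)
  N-A≡N-A₀ zero    _     = refl
  N-A≡N-A₀ (suc i) 1+i<k = begin
    N (A (suc i))    ≡⟨ N-cong {σ γ (A i)} {A (suc i)} σA≈A[1+i] ⟨
    N (σ γ (A i))    ≡⟨ N-σ (A i) ⟩
    N (A i)          ≡⟨ N-A≡N-A₀ i (ℕ.<-trans (ℕ.n<1+n i) 1+i<k) ⟩
    N (A 0)          ∎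
    where
    open ≡-Reasoning
    σA≈A[1+i] : σ γ (A i) ≈ζ A (suc i)
    σA≈A[1+i] = subst (λ j → σ γ (A i) ≈ζ A j)
                  (trans (cong (_% k) (ℕ.+-comm i 1)) (m<n⇒m%n≡m 1+i<k))
                  (A-cycle i (ℕ.<-trans (ℕ.n<1+n i) 1+i<k))

  module _ {t : ℕ} (c^k-order : IsOrder (c ^ k) t) where

    t∣N-A₀ : t ∣ N (A 0)
    t∣N-A₀ = Orbit.order-∣-count c^k-order (λ u → ¬? (u ≟ 0#) ×-dec (W u ≈ζ? A 0)) proj₁ closed
      where
      open ≈ζ-Reasoning
      closed : ∀ {u} → (u ≢ 0# × W u ≈ζ A 0) → (c ^ k * u ≢ 0# × W (c ^ k * u) ≈ζ A 0)
      closed {u} (u≢0 , Wu≈A₀) = *-≢0 (^-≢0 k c≢0) u≢0 , (begin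
        W (c ^ k * u)     ≈⟨ ≗⇒≈ζ (σ^-W k u) ⟨
        σ^ γ k (W u)      ≈⟨ σ^-cong k Wu≈A₀ ⟩
        σ^ γ k (A 0)      ≈⟨ σ^-A₀ k ⟩
        A (k % k)         ≡⟨ cong A (n%n≡0 k) ⟩
        A 0               ∎)

    m∣k*t : m ∣ k ℕ.* t
    m∣k*t = FixesW⇒m∣ fixes
      where
      open ≈ζ-Reasoning
      c^[k*t]≡1 : c ^ (k ℕ.* t) ≡ 1#
      c^[k*t]≡1 = trans (sym (^-assocʳ c k t)) (Orbit.e^t≡1 c^k-order)
      fixes : FixesW (k ℕ.* t)
      fixes B (u , _ , Wu≈B) = begin
        σ^ γ (k ℕ.* t) B          ≈⟨ σ^-cong (k ℕ.* t) Wu≈B ⟨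
        σ^ γ (k ℕ.* t) (W u)      ≈⟨ ≗⇒≈ζ (σ^-W (k ℕ.* t) u) ⟩
        W (c ^ (k ℕ.* t) * u)     ≡⟨ cong (λ x → W (x * u)) c^[k*t]≡1 ⟩
        W (1# * u)                ≡⟨ cong W (*-identityˡ u) ⟩
        W u                       ≈⟨ Wu≈B ⟩
        B                         ∎

  m/k∣N-A₀ : (m / k) ∣ N (A 0)
  m/k∣N-A₀ = let t , c^k-order = order-exists (^-≢0 k c≢0) in
    ∣-trans (m∣n*o⇒m/n∣o k∣m (m∣k*t c^k-order)) (t∣N-A₀ c^k-order)

open import Data.Nat using (_+_; _∸_; _^_)

lemma2p3 : (K : FiniteField) (p n s γ m k : ℕ) .{{_ : NonZero k}}
    → Prime p
    → FiniteField._×1 K p ≡ FiniteField.0# K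
    → FiniteField.order K ≡ p ^ n
    → 0 < s
    → gcd s (FiniteField.order K ∸ 1) ≡ 1
    → IsGenerator p γ
    → WeilSums.τHasOrder K p n s γ m
    → (A : ℕ → ℤ[ζ] p)
    → (∀ i → i < k → WeilSums.InW K p n s (A i))
    → (∀ i j → i < k → j < k → i ≢ j → ¬ (A i ≈ζ A j))
    → (∀ i → i < k → σ γ (A i) ≈ζ A ((i + 1) % k))
    → k ∣ m
      × (∀ i → i < k → WeilSums.N K p n s (A i) ≡ WeilSums.N K p n s (A 0))
      × (m / k) ∣ WeilSums.N K p n s (A 0)
lemma2p3 K zero n s γ m k p-prime = contradiction p-prime ¬prime[0]
lemma2p3 K (suc p-1) n s γ m k p-prime char q≡p^n _ gcd≡1 (0<γ , γ<p , _) τ-order A A-in-W A-distinct A-cycle =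
  k∣m , N-A≡N-A₀ , m/k∣N-A₀
  where
  s⊥p-1 : Coprime s p-1
  s⊥p-1 = gcd[s,[1+m]^n∸1]≡1⇒coprime n (subst (λ q → gcd s (q ∸ 1) ≡ 1) q≡p^n gcd≡1)
  open TauCycle K p-1 p-prime char n s s⊥p-1 γ 0<γ γ<p m τ-order k A A-in-W A-distinct A-cycle
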